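{- Let $Z$ be a finite set of $n$ points in a metric space with distance $d$. For $j=1,2$, let $\mathrm{sol}_j$ be a solution on $Z$ consisting of a center set $C_j$ with $|C_j|\le 2k$, a set $P_j\subseteq Z$ of clustered points with $|Z\setminus P_j|=t_{j}$ ignored points, and an assignment $\pi_j:P_j\to C_j$, with cost $c_j=\sum_{x\in P_j} d(x,\pi_j(x))$, where $t_1<t_2$ are integers. Let $t'$ be an integer with $t'=(1-\theta)t_1+\theta t_2$ for some $\theta\in(0,1)$. Consider the solution with center set $C_1\cup C_2$ (at most $4k$ centers) in which every point is attached to its nearest center in $C_1\cup C_2$ and the $t'$ points with the largest such distances are ignored. Its cost (sum of distances of non-ignored points to their centers) is at most $(1-\theta)c_1+\theta c_2$.
   Formalization: The distance $d$ of the metric space takes only rational values. -}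

module Defs where

open import Data.Nat as ℕ using (ℕ)
open import Data.Integer using (+_)
open import Data.Rational using (ℚ; 0ℚ; _+_; _/_; _≤_)
open import Data.Fin using (Fin; zero; suc)
open import Data.Fin.Subset using (Subset; _∈_; _∉_; ∁; ∣_∣)
open import Data.Fin.Subset.Properties using (_∈?_)
open import Data.Vec.Functional using (_++_)
open import Relation.Nullary using (yes; no)
open import Relation.Binary.PropositionalEquality using (_≡_)
open import Level using (Level)
open import Data.Product using (_×_)

ℕ→ℚ : ℕ → ℚ
ℕ→ℚ n = (+ n) / 1

sumFin : (n : ℕ) → (Fin n → ℚ) → ℚ
sumFin ℕ.zero    f = 0ℚ
sumFin (ℕ.suc n) f = f zero + sumFin n (λ i → f (suc i))

sumOver : {n : ℕ} (P : Subset n) → ((i : Fin n) → i ∈ P → ℚ) → ℚ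
sumOver {n} P f = sumFin n g
  where
  g : Fin n → ℚ
  g i with i ∈? P
  ... | yes i∈P = f i i∈P
  ... | no  _   = 0ℚ

record MetricSpace {a : Level} (M : Set a) : Set a where
  field
    d        : M → M → ℚ
    d-refl   : ∀ x → d x x ≡ 0ℚ
    d-zero   : ∀ x y → d x y ≡ 0ℚ → x ≡ y
    d-sym    : ∀ x y → d x y ≡ d y x
    d-tri    : ∀ x y z → d x z ≤ d x y + d y z

record Solution {a : Level} {M : Set a} (n : ℕ) : Set a where
  field
    m       : ℕ
    centers : Fin m → M
    P       : Subset n
    π       : (i : Fin n) → i ∈ P → Fin m

module _ {a : Level} {M : Set a} (MS : MetricSpace M) {n : ℕ} (Z : Fin n → M) where
  open MetricSpace MS

  ignored : Solution {M = M} n → ℕ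
  ignored s = ∣ ∁ (Solution.P s) ∣

  cost : Solution {M = M} n → ℚ
  cost s = sumOver P (λ i i∈P → d (Z i) (centers (π i i∈P)))
    where open Solution s

  IsNearest : {m : ℕ} (C : Fin m → M) (σ : Fin n → Fin m) → Set
  IsNearest {m} C σ = ∀ (i : Fin n) (c : Fin m) → d (Z i) (C (σ i)) ≤ d (Z i) (C c)

  IsLargestIgnored : (D : Fin n → ℚ) (t' : ℕ) (I : Subset n) → Set
  IsLargestIgnored D t' I =
    (∣ I ∣ ≡ t') × (∀ (i j : Fin n) → i ∈ I → j ∉ I → D j ≤ D i)

  -- union of the two center sets, as the concatenation of the index families
  unionCenters : (s₁ s₂ : Solution {M = M} n) → Fin (Solution.m s₁ ℕ.+ Solution.m s₂) → M
  unionCenters s₁ s₂ = Solution.centers s₁ ++ Solution.centers s₂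

{-# OPTIONS --safe #-}
module Submission where

-- Give each point x the weight w x = (1 - θ) [x ∈ P₁] + θ [x ∈ P₂] ∈ [0, 1]
-- and let D x be its distance to the nearest centre of C₁ ∪ C₂.  Since
-- D x ≤ d (x , π₁ x) and D x ≤ d (x , π₂ x), we get Σ w D ≤ (1 - θ) c₁ + θ c₂,
-- while Σ w = (1 - θ) (n - t₁) + θ (n - t₂) = n - t' is the number of points
-- that are kept.  The kept points are those of smallest D, and among all
-- weightings with values in [0, 1] and this total weight their indicator
-- minimises Σ w D: for a threshold T separating the values of D on kept and
-- ignored points, (w x - [x kept]) (D x - T) ≥ 0 for every x, and summing
-- gives Σ_kept D ≤ Σ w D.

-- A separate module, since the statement of lemma3p7 opens _+_ and _*_ of ℕ.
module WeightedSums where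

  open import Data.Nat.Base as ℕ using (zero; suc)
  import Data.Nat.Properties as ℕ
  import Data.Integer.Base as ℤ
  import Data.Integer.Properties as ℤₚ
  open import Data.Rational.Base
    using (ℚ; 0ℚ; 1ℚ; _+_; _*_; -_; _-_; _/_; _≤_; _⊔_; _⊓_; nonNegative; nonPositive)
  open import Data.Rational.Properties
  open import Data.Rational.Solver using (module +-*-Solver)
  import Data.Nat.Coprimality as Coprime
  open import Data.Bool.Base using (if_then_else_)
  open import Data.Fin.Base using (Fin; zero; suc)
  open import Data.Fin.Subset using (Subset; _∈_; _∉_; ∁; ∣_∣; inside; outside)
  open import Data.Fin.Subset.Properties using (_∈?_; drop-there; ∣p∣≤n; ∣∁p∣≡n∸∣p∣)
  open import Data.Vec.Base using ([]; _∷_; here; there)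
  open import Data.Vec.Functional using (Vector)
  open import Data.Product.Base using (∃-syntax; _×_; _,_)
  open import Function.Base using (_∘_)
  open import Relation.Nullary using (does; yes; no; contradiction)
  open import Relation.Binary.PropositionalEquality
    using (_≡_; refl; sym; cong; cong₂; trans; subst; subst₂; module ≡-Reasoning)
  open import Algebra.Bundles using (Ring)
  open import Algebra.Properties.Semiring.Sum (Ring.semiring +-*-ring)
    using (sum; sum-cong-≗; ∑-distrib-+; *-distribˡ-sum; *-distribʳ-sum)
  open import Defs
  open +-*-Solver

  ℕ→ℚ-suc : ∀ m → ℕ→ℚ (suc m) ≡ 1ℚ + ℕ→ℚ m
  -- ℕ→ℚ m is the normal form m / 1, on which 1ℚ + ℕ→ℚ m computes to (1 * 1 + m * 1) / 1.
  ℕ→ℚ-suc m rewrite normalize-coprime (Coprime.sym (Coprime.1-coprimeTo m)) =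
    cong (λ z → (ℤ.+ 1 ℤ.+ z) / 1) (sym (ℤₚ.*-identityʳ (ℤ.+ m)))

  ℕ→ℚ-+ : ∀ m n → ℕ→ℚ (m ℕ.+ n) ≡ ℕ→ℚ m + ℕ→ℚ n
  ℕ→ℚ-+ zero    n = sym (+-identityˡ (ℕ→ℚ n))
  ℕ→ℚ-+ (suc m) n = begin
    ℕ→ℚ (suc (m ℕ.+ n))          ≡⟨ ℕ→ℚ-suc (m ℕ.+ n) ⟩
    1ℚ + ℕ→ℚ (m ℕ.+ n)           ≡⟨ cong (1ℚ +_) (ℕ→ℚ-+ m n) ⟩
    1ℚ + (ℕ→ℚ m + ℕ→ℚ n)         ≡⟨ +-assoc 1ℚ (ℕ→ℚ m) (ℕ→ℚ n) ⟨
    1ℚ + ℕ→ℚ m + ℕ→ℚ n           ≡⟨ cong (_+ ℕ→ℚ n) (ℕ→ℚ-suc m) ⟨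
    ℕ→ℚ (suc m) + ℕ→ℚ n          ∎
    where open ≡-Reasoning

  p+q≡r⇒p≡r-q : ∀ {p q r} → p + q ≡ r → p ≡ r - q
  p+q≡r⇒p≡r-q {p} {q} refl = solve 2 (λ p q → p := p :+ q :- q) refl p q

  p+q≡r⇒q≡r-p : ∀ {p q r} → p + q ≡ r → q ≡ r - p
  p+q≡r⇒q≡r-p {p} {q} refl = solve 2 (λ p q → q := p :+ q :- p) refl p q

  p≤q⇒0≤q-p : ∀ {p q} → p ≤ q → 0ℚ ≤ q - p
  p≤q⇒0≤q-p {p} {q} p≤q = begin
    0ℚ     ≡⟨ +-inverseʳ p ⟨
    p - p  ≤⟨ +-monoˡ-≤ (- p) p≤q ⟩
    q - p  ∎
    where open ≤-Reasoning

  p≤q⇒p-q≤0 : ∀ {p q} → p ≤ q → p - q ≤ 0ℚ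
  p≤q⇒p-q≤0 {p} {q} p≤q = begin
    p - q  ≤⟨ +-monoˡ-≤ (- q) p≤q ⟩
    q - q  ≡⟨ +-inverseʳ q ⟩
    0ℚ     ∎
    where open ≤-Reasoning

  ∣p∣+∣∁p∣≡n : ∀ {n} (p : Subset n) → ℕ→ℚ ∣ p ∣ + ℕ→ℚ ∣ ∁ p ∣ ≡ ℕ→ℚ n
  ∣p∣+∣∁p∣≡n {n} p = begin
    ℕ→ℚ ∣ p ∣ + ℕ→ℚ ∣ ∁ p ∣        ≡⟨ ℕ→ℚ-+ ∣ p ∣ ∣ ∁ p ∣ ⟨
    ℕ→ℚ (∣ p ∣ ℕ.+ ∣ ∁ p ∣)        ≡⟨ cong (ℕ→ℚ ∘ (∣ p ∣ ℕ.+_)) (∣∁p∣≡n∸∣p∣ p) ⟩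
    ℕ→ℚ (∣ p ∣ ℕ.+ (n ℕ.∸ ∣ p ∣))  ≡⟨ cong ℕ→ℚ (ℕ.m+[n∸m]≡n (∣p∣≤n p)) ⟩
    ℕ→ℚ n                          ∎
    where open ≡-Reasoning

  convex : ℚ → ℚ → ℚ → ℚ
  convex θ x y = (1ℚ - θ) * x + θ * y

  convex-idem : ∀ θ x → convex θ x x ≡ x
  convex-idem θ x = solve 2 (λ θ x → (con 1ℚ :- θ) :* x :+ θ :* x := x) refl θ x

  convex-*-distribʳ : ∀ θ x y z → convex θ x y * z ≡ convex θ (x * z) (y * z)
  convex-*-distribʳ θ x y z = solve 4 (λ θ x y z →
    ((con 1ℚ :- θ) :* x :+ θ :* y) :* z := (con 1ℚ :- θ) :* (x :* z) :+ θ :* (y :* z)) refl θ x y z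

  convex-sub : ∀ θ N x y → convex θ (N - x) (N - y) ≡ N - convex θ x y
  convex-sub θ N x y = solve 4 (λ θ N x y →
    (con 1ℚ :- θ) :* (N :- x) :+ θ :* (N :- y) := N :- ((con 1ℚ :- θ) :* x :+ θ :* y)) refl θ N x y

  module _ {θ : ℚ} (0≤θ : 0ℚ ≤ θ) (θ≤1 : θ ≤ 1ℚ) where

    convex-mono-≤ : ∀ {x x′ y y′} → x ≤ x′ → y ≤ y′ → convex θ x y ≤ convex θ x′ y′
    convex-mono-≤ x≤x′ y≤y′ = +-mono-≤
      (*-monoˡ-≤-nonNeg (1ℚ - θ) {{nonNegative (p≤q⇒0≤q-p θ≤1)}} x≤x′)
      (*-monoˡ-≤-nonNeg θ {{nonNegative 0≤θ}} y≤y′)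

    ≤-convex : ∀ {c x y} → c ≤ x → c ≤ y → c ≤ convex θ x y
    ≤-convex {c} c≤x c≤y = subst (_≤ _) (convex-idem θ c) (convex-mono-≤ c≤x c≤y)

    convex-≤ : ∀ {c x y} → x ≤ c → y ≤ c → convex θ x y ≤ c
    convex-≤ {c} x≤c y≤c = subst (_ ≤_) (convex-idem θ c) (convex-mono-≤ x≤c y≤c)

  sumFin≡sum : ∀ n (f : Vector ℚ n) → sumFin n f ≡ sum f
  sumFin≡sum zero    f = refl
  sumFin≡sum (suc n) f = cong (f zero +_) (sumFin≡sum n (f ∘ suc))

  sum-mono-≤ : ∀ {n} {f g : Vector ℚ n} → (∀ i → f i ≤ g i) → sum f ≤ sum g
  sum-mono-≤ {zero}  f≤g = ≤-refl
  sum-mono-≤ {suc n} f≤g = +-mono-≤ (f≤g zero) (sum-mono-≤ (f≤g ∘ suc))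

  sum-convex : ∀ {n} θ (f g : Vector ℚ n) →
               sum (λ i → convex θ (f i) (g i)) ≡ convex θ (sum f) (sum g)
  sum-convex θ f g = trans (∑-distrib-+ (λ i → (1ℚ - θ) * f i) (λ i → θ * g i))
    (sym (cong₂ _+_ (*-distribˡ-sum (1ℚ - θ) f) (*-distribˡ-sum θ g)))

  extendByZero : ∀ {n} (P : Subset n) → ((i : Fin n) → i ∈ P → ℚ) → Vector ℚ n
  extendByZero P f i with i ∈? P
  ... | yes i∈P = f i i∈P
  ... | no  _   = 0ℚ

  indicator : ∀ {n} → Subset n → Vector ℚ n
  indicator P i = if does (i ∈? P) then 1ℚ else 0ℚ

  -- The left-hand side is the summand in the definition of sumOver, which has
  -- no name; it is inferred from the use in sumOver≡sum-extendByZero.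
  sumOver-summand : ∀ {n} (P : Subset n) f i → _ ≡ extendByZero P f i

  sumOver≡sum-extendByZero : ∀ {n} (P : Subset n) f → sumOver P f ≡ sum (extendByZero P f)
  sumOver≡sum-extendByZero {n} P f =
    trans (sumFin≡sum n _) (sum-cong-≗ (sumOver-summand P f))

  sumOver-summand P f i with i ∈? P
  ... | yes _ = refl
  ... | no  _ = refl

  sumOver-mono-≤ : ∀ {n} (P : Subset n) {f g} →
                   (∀ i (i∈P : i ∈ P) → f i i∈P ≤ g i i∈P) → sumOver P f ≤ sumOver P g
  sumOver-mono-≤ P {f} {g} f≤g = subst₂ _≤_
    (sym (sumOver≡sum-extendByZero P f)) (sym (sumOver≡sum-extendByZero P g))
    (sum-mono-≤ extendByZero-mono-≤)
    where
    extendByZero-mono-≤ : ∀ i → extendByZero P f i ≤ extendByZero P g i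
    extendByZero-mono-≤ i with i ∈? P
    ... | yes i∈P = f≤g i i∈P
    ... | no  _   = ≤-refl

  sumOver≡sum-indicator* : ∀ {n} (P : Subset n) (f : Vector ℚ n) →
                  sumOver P (λ i _ → f i) ≡ sum (λ i → indicator P i * f i)
  sumOver≡sum-indicator* P f =
    trans (sumOver≡sum-extendByZero P _) (sum-cong-≗ extendByZero≡indicator*)
    where
    extendByZero≡indicator* : ∀ i → extendByZero P (λ i _ → f i) i ≡ indicator P i * f i
    extendByZero≡indicator* i with i ∈? P
    ... | yes _ = sym (*-identityˡ (f i))
    ... | no  _ = sym (*-zeroˡ (f i))

  sum-indicator : ∀ {n} (P : Subset n) → sum (indicator P) ≡ ℕ→ℚ ∣ P ∣
  sum-indicator []            = refl
  sum-indicator (inside  ∷ P) = trans (cong (1ℚ +_) (sum-indicator P)) (sym (ℕ→ℚ-suc ∣ P ∣))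
  sum-indicator (outside ∷ P) = trans (+-identityˡ _) (sum-indicator P)

  0≤indicator : ∀ {n} (P : Subset n) i → 0ℚ ≤ indicator P i
  0≤indicator P i with i ∈? P
  ... | yes _ = nonNegative⁻¹ 1ℚ
  ... | no  _ = ≤-refl

  indicator≤1 : ∀ {n} (P : Subset n) i → indicator P i ≤ 1ℚ
  indicator≤1 P i with i ∈? P
  ... | yes _ = ≤-refl
  ... | no  _ = nonNegative⁻¹ 1ℚ

  Lowest : ∀ {n} → Vector ℚ n → Subset n → Set
  Lowest D J = ∀ {i j} → i ∈ J → j ∉ J → D i ≤ D j

  lowest⇒threshold : ∀ {n} (J : Subset n) (D : Vector ℚ n) → Lowest D J →
                     ∃[ T ] (∀ {i} → i ∈ J → D i ≤ T) × (∀ {j} → j ∉ J → T ≤ D j)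
  lowest⇒threshold []      D lowest = 0ℚ , (λ { {()} }) , (λ { {()} })
  lowest⇒threshold (b ∷ J) D lowest
    with lowest⇒threshold J (D ∘ suc) (λ i∈J j∉J → lowest (there i∈J) (j∉J ∘ drop-there))
  lowest⇒threshold (inside ∷ J) D lowest | T , below , above = D zero ⊔ T , below′ , above′
    where
    below′ : ∀ {i} → i ∈ inside ∷ J → D i ≤ D zero ⊔ T
    below′ here        = p≤p⊔q (D zero) T
    below′ (there i∈J) = p≤q⇒p≤r⊔q (D zero) (below i∈J)
    above′ : ∀ {j} → j ∉ inside ∷ J → D zero ⊔ T ≤ D j
    above′ {zero}  j∉J = contradiction here j∉J
    above′ {suc j} j∉J = ⊔-lub (lowest here j∉J) (above (j∉J ∘ there))
  lowest⇒threshold (outside ∷ J) D lowest | T , below , above = D zero ⊓ T , below′ , above′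
    where
    below′ : ∀ {i} → i ∈ outside ∷ J → D i ≤ D zero ⊓ T
    below′ (there i∈J) = ⊓-glb (lowest (there i∈J) (λ ())) (below i∈J)
    above′ : ∀ {j} → j ∉ outside ∷ J → D zero ⊓ T ≤ D j
    above′ {zero}  _   = p⊓q≤p (D zero) T
    above′ {suc j} j∉J = p≤q⇒r⊓p≤q (D zero) (above (j∉J ∘ there))

  sum-exchange-≤ : ∀ {n} (e w D : Vector ℚ n) T →
                   (∀ i → e i * (D i - T) ≤ w i * (D i - T)) → sum e ≡ sum w →
                   sum (λ i → e i * D i) ≤ sum (λ i → w i * D i)
  sum-exchange-≤ e w D T e≤w Σe≡Σw = begin
    sum (λ i → e i * D i)                     ≡⟨ split e ⟩
    sum (λ i → e i * (D i - T)) + sum e * T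
      ≤⟨ +-mono-≤ (sum-mono-≤ e≤w) (≤-reflexive (cong (_* T) Σe≡Σw)) ⟩
    sum (λ i → w i * (D i - T)) + sum w * T   ≡⟨ split w ⟨
    sum (λ i → w i * D i)                     ∎
    where
    open ≤-Reasoning
    split : ∀ v → sum (λ i → v i * D i) ≡ sum (λ i → v i * (D i - T)) + sum v * T
    split v = trans (sum-cong-≗ shift)
      (trans (∑-distrib-+ (λ i → v i * (D i - T)) (λ i → v i * T))
             (cong (sum (λ i → v i * (D i - T)) +_) (sym (*-distribʳ-sum T v))))
      where
      shift : ∀ i → v i * D i ≡ v i * (D i - T) + v i * T
      shift i = solve 3 (λ v d T → v :* d := v :* (d :- T) :+ v :* T) refl (v i) (D i) T

  lowest-minimises : ∀ {n} (J : Subset n) (w D : Vector ℚ n) →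
                     (∀ i → 0ℚ ≤ w i) → (∀ i → w i ≤ 1ℚ) → Lowest D J →
                     sum w ≡ sum (indicator J) →
                     sum (λ i → indicator J i * D i) ≤ sum (λ i → w i * D i)
  lowest-minimises J w D 0≤w w≤1 lowest Σw≡Σ𝟙 with lowest⇒threshold J D lowest
  ... | T , below , above = sum-exchange-≤ (indicator J) w D T exchange (sym Σw≡Σ𝟙)
    where
    exchange : ∀ i → indicator J i * (D i - T) ≤ w i * (D i - T)
    exchange i with i ∈? J
    ... | yes i∈J = *-monoʳ-≤-nonPos (D i - T) {{nonPositive (p≤q⇒p-q≤0 (below i∈J))}} (w≤1 i)
    ... | no  i∉J = *-monoʳ-≤-nonNeg (D i - T) {{nonNegative (p≤q⇒0≤q-p (above i∉J))}} (0≤w i)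

  sum-convex-indicator : ∀ {n} θ (P Q : Subset n) →
                         sum (λ i → convex θ (indicator P i) (indicator Q i)) ≡
                         convex θ (ℕ→ℚ ∣ P ∣) (ℕ→ℚ ∣ Q ∣)
  sum-convex-indicator θ P Q = trans (sum-convex θ (indicator P) (indicator Q))
    (cong₂ (convex θ) (sum-indicator P) (sum-indicator Q))

  sum-convex-indicator* : ∀ {n} θ (P Q : Subset n) (f : Vector ℚ n) →
                          sum (λ i → convex θ (indicator P i) (indicator Q i) * f i) ≡
                          convex θ (sumOver P (λ i _ → f i)) (sumOver Q (λ i _ → f i))
  sum-convex-indicator* θ P Q f = begin
    sum (λ i → convex θ (indicator P i) (indicator Q i) * f i)
      ≡⟨ sum-cong-≗ (λ i → convex-*-distribʳ θ (indicator P i) (indicator Q i) (f i)) ⟩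
    sum (λ i → convex θ (indicator P i * f i) (indicator Q i * f i))
      ≡⟨ sum-convex θ (λ i → indicator P i * f i) (λ i → indicator Q i * f i) ⟩
    convex θ (sum (λ i → indicator P i * f i)) (sum (λ i → indicator Q i * f i))
      ≡⟨ cong₂ (convex θ) (sumOver≡sum-indicator* P f) (sumOver≡sum-indicator* Q f) ⟨
    convex θ (sumOver P (λ i _ → f i)) (sumOver Q (λ i _ → f i))
      ∎
    where open ≡-Reasoning

  convex-∣∁∣ : ∀ {n} θ (P₁ P₂ I : Subset n) →
               ℕ→ℚ ∣ I ∣ ≡ convex θ (ℕ→ℚ ∣ ∁ P₁ ∣) (ℕ→ℚ ∣ ∁ P₂ ∣) →
               convex θ (ℕ→ℚ ∣ P₁ ∣) (ℕ→ℚ ∣ P₂ ∣) ≡ ℕ→ℚ ∣ ∁ I ∣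
  convex-∣∁∣ {n} θ P₁ P₂ I ∣I∣≡ = begin
    convex θ (ℕ→ℚ ∣ P₁ ∣) (ℕ→ℚ ∣ P₂ ∣)
      ≡⟨ cong₂ (convex θ) (p+q≡r⇒p≡r-q (∣p∣+∣∁p∣≡n P₁)) (p+q≡r⇒p≡r-q (∣p∣+∣∁p∣≡n P₂)) ⟩
    convex θ (ℕ→ℚ n - ℕ→ℚ ∣ ∁ P₁ ∣) (ℕ→ℚ n - ℕ→ℚ ∣ ∁ P₂ ∣)
      ≡⟨ convex-sub θ (ℕ→ℚ n) (ℕ→ℚ ∣ ∁ P₁ ∣) (ℕ→ℚ ∣ ∁ P₂ ∣) ⟩
    ℕ→ℚ n - convex θ (ℕ→ℚ ∣ ∁ P₁ ∣) (ℕ→ℚ ∣ ∁ P₂ ∣)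
      ≡⟨ cong (λ t → ℕ→ℚ n - t) ∣I∣≡ ⟨
    ℕ→ℚ n - ℕ→ℚ ∣ I ∣
      ≡⟨ p+q≡r⇒q≡r-p (∣p∣+∣∁p∣≡n I) ⟨
    ℕ→ℚ ∣ ∁ I ∣
      ∎
    where open ≡-Reasoning

open import Defs
open import Level using (Level)
open import Data.Nat using (ℕ; _*_; _+_)
open import Data.Nat as ℕ using ()
open import Data.Rational using (ℚ; 0ℚ; 1ℚ; _<_; _≤_; _-_)
open import Data.Rational as ℚ using ()
open import Data.Rational.Properties using (<⇒≤; +-*-ring; module ≤-Reasoning)
open import Data.Fin using (Fin; _↑ˡ_; _↑ʳ_)
open import Data.Fin.Subset using (Subset; _∈_; _∉_; ∁)
open import Data.Fin.Subset.Properties using (x∈∁p⇒x∉p; x∉∁p⇒x∈p)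
open import Data.Vec.Functional.Properties using (lookup-++ˡ; lookup-++ʳ)
open import Data.Product using (_,_)
open import Algebra.Bundles using (Ring)
open import Algebra.Properties.Semiring.Sum (Ring.semiring +-*-ring) using (sum)
open import Function.Definitions using (Injective)
open import Relation.Binary.PropositionalEquality using (_≡_; refl; sym; trans; cong; subst)
open WeightedSums

module _ {a : Level} {M : Set a} (MS : MetricSpace M) {n : ℕ} (Z : Fin n → M) where
  open MetricSpace MS

  nearest≤cost : ∀ {m} {C : Fin m → M} {σ : Fin n → Fin m} → IsNearest MS Z C σ →
                 (s : Solution {M = M} n) (ι : Fin (Solution.m s) → Fin m) →
                 (∀ c → C (ι c) ≡ Solution.centers s c) →
                 sumOver (Solution.P s) (λ i _ → d (Z i) (C (σ i))) ≤ cost MS Z s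
  nearest≤cost {C = C} {σ} nearest s ι C∘ι≡centers = sumOver-mono-≤ P λ i i∈P →
    subst (d (Z i) (C (σ i)) ≤_) (cong (d (Z i)) (C∘ι≡centers (π i i∈P))) (nearest i (ι (π i i∈P)))
    where open Solution s

lemma3p7 : ∀ {a : Level} {M : Set a} (MS : MetricSpace M) (n k : ℕ) (Z : Fin n → M)
    → Injective _≡_ _≡_ Z
    → (sol₁ sol₂ : Solution {M = M} n)
    → Solution.m sol₁ ℕ.≤ 2 * k → Solution.m sol₂ ℕ.≤ 2 * k
    → (t₁ t₂ : ℕ) → ignored MS Z sol₁ ≡ t₁ → ignored MS Z sol₂ ≡ t₂
    → t₁ ℕ.< t₂
    → (t' : ℕ) (θ : ℚ) → 0ℚ < θ → θ < 1ℚ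
    → ℕ→ℚ t' ≡ (1ℚ - θ) ℚ.* ℕ→ℚ t₁ ℚ.+ θ ℚ.* ℕ→ℚ t₂
    → (σ : Fin n → Fin (Solution.m sol₁ + Solution.m sol₂))
    → IsNearest MS Z (unionCenters MS Z sol₁ sol₂) σ
    → (I : Subset n)
    → IsLargestIgnored MS Z
        (λ i → MetricSpace.d MS (Z i) (unionCenters MS Z sol₁ sol₂ (σ i))) t' I
    → sumOver (∁ I)
        (λ i _ → MetricSpace.d MS (Z i) (unionCenters MS Z sol₁ sol₂ (σ i)))
      ≤ (1ℚ - θ) ℚ.* cost MS Z sol₁ ℚ.+ θ ℚ.* cost MS Z sol₂
lemma3p7 MS n k Z _ sol₁ sol₂ _ _ _ _ refl refl _ _ θ 0<θ θ<1 ∣I∣≡ σ nearest I (refl , largest) =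
  begin
    sumOver (∁ I) (λ i _ → D i)             ≡⟨ sumOver≡sum-indicator* (∁ I) D ⟩
    sum (λ i → indicator (∁ I) i ℚ.* D i)   ≤⟨ lowest-minimises (∁ I) w D 0≤w w≤1 kept-lowest Σw≡Σ𝟙∁I ⟩
    sum (λ i → w i ℚ.* D i)                 ≡⟨ sum-convex-indicator* θ P₁ P₂ D ⟩
    convex θ (sumOver P₁ (λ i _ → D i)) (sumOver P₂ (λ i _ → D i))
      ≤⟨ convex-mono-≤ 0≤θ θ≤1 (nearest≤cost MS Z nearest sol₁ (_↑ˡ m₂) (lookup-++ˡ C₁ C₂))
                               (nearest≤cost MS Z nearest sol₂ (m₁ ↑ʳ_) (lookup-++ʳ C₁ C₂)) ⟩
    convex θ (cost MS Z sol₁) (cost MS Z sol₂)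
      ∎
  where
  open ≤-Reasoning
  open Solution sol₁ using () renaming (m to m₁; centers to C₁; P to P₁)
  open Solution sol₂ using () renaming (m to m₂; centers to C₂; P to P₂)
  D : Fin n → ℚ
  D i = MetricSpace.d MS (Z i) (unionCenters MS Z sol₁ sol₂ (σ i))
  w : Fin n → ℚ
  w i = convex θ (indicator P₁ i) (indicator P₂ i)
  0≤θ : 0ℚ ≤ θ
  0≤θ = <⇒≤ 0<θ
  θ≤1 : θ ≤ 1ℚ
  θ≤1 = <⇒≤ θ<1
  0≤w : ∀ i → 0ℚ ≤ w i
  0≤w i = ≤-convex 0≤θ θ≤1 (0≤indicator P₁ i) (0≤indicator P₂ i)
  w≤1 : ∀ i → w i ≤ 1ℚ
  w≤1 i = convex-≤ 0≤θ θ≤1 (indicator≤1 P₁ i) (indicator≤1 P₂ i)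
  kept-lowest : Lowest D (∁ I)
  kept-lowest i∈∁I j∉∁I = largest _ _ (x∉∁p⇒x∈p j∉∁I) (x∈∁p⇒x∉p i∈∁I)
  Σw≡Σ𝟙∁I : sum w ≡ sum (indicator (∁ I))
  Σw≡Σ𝟙∁I = trans (sum-convex-indicator θ P₁ P₂)
              (trans (convex-∣∁∣ θ P₁ P₂ I ∣I∣≡) (sym (sum-indicator (∁ I))))
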